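{- Let $\varphi$ be a QF symbolic heap, $I$ a finite set, and $\phi_i$ ($i\in I$) symbolic heaps, and let $s$ be a store. Then $s\models\varphi\to\bigvee_{i\in I}\phi_i$ holds if and only if, for every $\varphi'\in{\rm Perm}(\varphi)$, $s\models\widetilde{\varphi'}\to\bigvee\{\widetilde{\phi'}\mid i\in I,\ \phi'\in{\rm Perm}(\phi_i)\}$.
   Context: Terms: $t::=x\mid 0\mid 1\mid\cdots\mid t+t$. Pure formulas are Presburger formulas over these terms. Spatial formulas $\Sigma::={\rm emp}\mid t\mapsto t\mid{\rm Arr}(t,t)\mid\Sigma*\Sigma$, regarded as lists of atoms. A symbolic heap is $\exists\overrightarrow x(\Pi\land\Sigma)$ with $\Pi$ pure and $\Sigma$ spatial; a QF symbolic heap is one of the form $\Pi\land\Sigma$. Semantics: values $\mathbb N$, locations $\mathbb N\setminus\{0\}$, stores map variables to $\mathbb N$, heaps are finite partial functions from locations to $\mathbb N$; $s,h\models{\rm emp}$ iff ${\rm Dom}(h)=\emptyset$; $s,h\models t\mapsto u$ iff ${\rm Dom}(h)=\{s(t)\}$ and $h(s(t))=s(u)$; $s,h\models{\rm Arr}(t,u)$ iff $s(t)\le s(u)$ and ${\rm Dom}(h)=\{x\mid s(t)\le x\le s(u)\}$; $*$ is disjoint union of heaps; other connectives as usual. $s\models\varphi$ means $s,h\models\varphi$ for every heap $h$. Sortedness: $t<{\rm emp}:={\rm true}$; $t<({\rm emp}*\Sigma_1):=t<\Sigma_1$; $t<(t_1\mapsto u_1*\Sigma_1):=t<t_1$; $t<({\rm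 Arr}(t_1,u_1)*\Sigma_1):=t<t_1$; ${\rm Sorted}'({\rm emp}):={\rm true}$; ${\rm Sorted}'({\rm emp}*\Sigma_1):={\rm Sorted}'(\Sigma_1)$; ${\rm Sorted}'(t\mapsto u*\Sigma_1):=t<\Sigma_1\land{\rm Sorted}'(\Sigma_1)$; ${\rm Sorted}'({\rm Arr}(t,u)*\Sigma_1):=t\le u\land u<\Sigma_1\land{\rm Sorted}'(\Sigma_1)$; ${\rm Sorted}(\Sigma):=0<\Sigma\land{\rm Sorted}'(\Sigma)$. For a symbolic heap $\phi=\exists\overrightarrow x(\Pi\land\Sigma)$, $\widetilde\phi$ is $\exists\overrightarrow x(\Pi\land{\rm Sorted}(\Sigma)\land\Sigma)$. ${\rm Perm}(\phi)$ is the set of symbolic heaps obtained from $\phi$ by permuting the atoms of its spatial part with respect to $*$, leaving everything else unchanged. -}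

module Defs where

open import Data.Nat using (ℕ; zero; suc; _≤_; _<_)
import Data.Nat as N
open import Data.Maybe using (Maybe; just; nothing)
open import Data.List using (List; []; _∷_)
open import Data.List.Membership.Propositional using (_∈_; _∉_)
open import Data.List.Relation.Binary.Permutation.Propositional using (_↭_)
open import Data.Product using (Σ; ∃; _×_; _,_)
open import Data.Sum using (_⊎_)
open import Data.Unit using (⊤)
open import Data.Empty using (⊥)
open import Relation.Nullary using (¬_)
open import Relation.Binary.PropositionalEquality using (_≡_; _≢_)

Var : Set
Var = ℕ

data Term : Set where
  var  : Var → Term
  num  : ℕ → Term
  _⊕_  : Term → Term → Term

data Pure : Set where
  ptrue pfalse : Pure
  _≐_ _≤ₚ_ _<ₚ_ : Term → Term → Pure
  ¬ₚ_ : Pure → Pure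
  _∧ₚ_ _∨ₚ_ _⇒ₚ_ : Pure → Pure → Pure
  ∀ₚ ∃ₚ : Var → Pure → Pure

-- Spatial atoms; a spatial formula is a list of atoms (joined by *)
data Atom : Set where
  emp : Atom
  _↦_ : Term → Term → Atom
  Arr : Term → Term → Atom

Spatial : Set
Spatial = List Atom

record SymHeap : Set where
  constructor ∃[_]⟨_∧_⟩
  field
    vars    : List Var
    pure    : Pure
    spatial : Spatial
open SymHeap public

QF : SymHeap → Set
QF φ = vars φ ≡ []

Store : Set
Store = Var → ℕ

_[_≔_] : Store → Var → ℕ → Store
(s [ x ≔ n ]) y with x N.≟ y
... | Relation.Nullary.yes _ = n
... | Relation.Nullary.no  _ = s y

⟦_⟧t : Term → Store → ℕ
⟦ var x ⟧t s = s x
⟦ num n ⟧t s = n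
⟦ t ⊕ u ⟧t s = ⟦ t ⟧t s N.+ ⟦ u ⟧t s

_⊨ₚ_ : Store → Pure → Set
s ⊨ₚ ptrue = ⊤
s ⊨ₚ pfalse = ⊥
s ⊨ₚ (t ≐ u) = ⟦ t ⟧t s ≡ ⟦ u ⟧t s
s ⊨ₚ (t ≤ₚ u) = ⟦ t ⟧t s ≤ ⟦ u ⟧t s
s ⊨ₚ (t <ₚ u) = ⟦ t ⟧t s < ⟦ u ⟧t s
s ⊨ₚ (¬ₚ P) = ¬ (s ⊨ₚ P)
s ⊨ₚ (P ∧ₚ Q) = (s ⊨ₚ P) × (s ⊨ₚ Q)
s ⊨ₚ (P ∨ₚ Q) = (s ⊨ₚ P) ⊎ (s ⊨ₚ Q)
s ⊨ₚ (P ⇒ₚ Q) = (s ⊨ₚ P) → (s ⊨ₚ Q)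
s ⊨ₚ (∀ₚ x P) = (n : ℕ) → (s [ x ≔ n ]) ⊨ₚ P
s ⊨ₚ (∃ₚ x P) = Σ ℕ λ n → (s [ x ≔ n ]) ⊨ₚ P

record Heap : Set where
  field
    at     : ℕ → Maybe ℕ
    at-0   : at 0 ≡ nothing
    finite : Σ ℕ λ b → (n : ℕ) → b ≤ n → at n ≡ nothing
open Heap public

InDom : Heap → ℕ → Set
InDom h n = Σ ℕ λ v → at h n ≡ just v

_∪ₘ_ : Maybe ℕ → Maybe ℕ → Maybe ℕ
just v  ∪ₘ _ = just v
nothing ∪ₘ m = m

_≡_⊎ₕ_ : Heap → Heap → Heap → Set
h ≡ h₁ ⊎ₕ h₂ = ((n : ℕ) → (at h₁ n ≡ nothing) ⊎ (at h₂ n ≡ nothing))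
             × ((n : ℕ) → at h n ≡ (at h₁ n ∪ₘ at h₂ n))

_,_⊨ₐ_ : Store → Heap → Atom → Set
s , h ⊨ₐ emp = (n : ℕ) → at h n ≡ nothing
s , h ⊨ₐ (t ↦ u) = (at h (⟦ t ⟧t s) ≡ just (⟦ u ⟧t s))
                 × ((n : ℕ) → n ≢ ⟦ t ⟧t s → at h n ≡ nothing)
s , h ⊨ₐ Arr t u = (⟦ t ⟧t s ≤ ⟦ u ⟧t s)
                 × ((n : ℕ) → (InDom h n → (⟦ t ⟧t s ≤ n × n ≤ ⟦ u ⟧t s))
                            × ((⟦ t ⟧t s ≤ n × n ≤ ⟦ u ⟧t s) → InDom h n))

_,_⊨ₛ_ : Store → Heap → Spatial → Set
s , h ⊨ₛ [] = s , h ⊨ₐ emp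
s , h ⊨ₛ (a ∷ Σs) = Σ Heap λ h₁ → Σ Heap λ h₂ →
                      (h ≡ h₁ ⊎ₕ h₂) × (s , h₁ ⊨ₐ a) × (s , h₂ ⊨ₛ Σs)

AgreeOutside : List Var → Store → Store → Set
AgreeOutside xs s s' = (y : Var) → y ∉ xs → s' y ≡ s y

_,_⊨_ : Store → Heap → SymHeap → Set
s , h ⊨ φ = Σ Store λ s' → AgreeOutside (vars φ) s s'
                         × (s' ⊨ₚ pure φ) × (s' , h ⊨ₛ spatial φ)

_<ˢ_ : Term → Spatial → Pure
t <ˢ [] = ptrue
t <ˢ (emp ∷ Σs) = t <ˢ Σs
t <ˢ ((t₁ ↦ u₁) ∷ Σs) = t <ₚ t₁
t <ˢ (Arr t₁ u₁ ∷ Σs) = t <ₚ t₁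

Sorted′ : Spatial → Pure
Sorted′ [] = ptrue
Sorted′ (emp ∷ Σs) = Sorted′ Σs
Sorted′ ((t ↦ u) ∷ Σs) = (t <ˢ Σs) ∧ₚ Sorted′ Σs
Sorted′ (Arr t u ∷ Σs) = (t ≤ₚ u) ∧ₚ ((u <ˢ Σs) ∧ₚ Sorted′ Σs)

Sorted : Spatial → Pure
Sorted Σs = (num 0 <ˢ Σs) ∧ₚ Sorted′ Σs

tilde : SymHeap → SymHeap
tilde φ = ∃[ vars φ ]⟨ pure φ ∧ₚ Sorted (spatial φ) ∧ spatial φ ⟩

_∈Perm_ : SymHeap → SymHeap → Set
φ' ∈Perm φ = (vars φ' ≡ vars φ) × (pure φ' ≡ pure φ) × (spatial φ ↭ spatial φ')

module Submission where

-- Satisfaction of a spatial formula is invariant under permuting its atoms, because disjoint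
-- union of heaps is associative and commutative. Moreover the non-empty atoms of a model occupy
-- pairwise disjoint non-empty intervals of positive locations, so insertion sort by interval
-- turns every model of Σ into a model of a permutation of Σ that satisfies Sorted. Hence φ and
-- the sorted permutations of φ have the same models, and the same holds for each ϕ i.

open import Defs
open import Data.Nat using (ℕ; zero; suc; _≤_; _<_; _<?_; _⊔_; z≤n; s≤s)
open import Data.Nat.Properties using (≤-trans; ≤-refl; ≤-antisym; ≮⇒≥; ⊔-lub; m≤m⊔n; m≤n⊔m)
open import Data.Maybe using (Maybe; just; nothing)
open import Data.List using ([]; _∷_)
open import Data.List.Relation.Binary.Permutation.Propositional
  using (_↭_; refl; prep; swap; trans; ↭-sym)
open import Data.Fin using (Fin)
open import Data.Product using (Σ; ∃; _×_; _,_; proj₁; proj₂)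
open import Data.Sum using (_⊎_; inj₁; inj₂)
open import Data.Unit using (⊤; tt)
open import Data.Empty using (⊥; ⊥-elim)
open import Relation.Nullary using (yes; no)
open import Relation.Binary.PropositionalEquality
  using (_≡_; cong; cong₂; subst; sym) renaming (refl to ≡-refl; trans to ≡-trans)
open import Function.Bundles using (_⇔_; mk⇔)

_∪ₕ_ : Heap → Heap → Heap
at (h₁ ∪ₕ h₂) n = at h₁ n ∪ₘ at h₂ n
at-0 (h₁ ∪ₕ h₂) = cong₂ _∪ₘ_ (at-0 h₁) (at-0 h₂)
finite (h₁ ∪ₕ h₂) =
  let b₁ , free₁ = finite h₁ ; b₂ , free₂ = finite h₂
  in b₁ ⊔ b₂ , λ n b≤n → cong₂ _∪ₘ_ (free₁ n (≤-trans (m≤m⊔n b₁ b₂) b≤n))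
                                   (free₂ n (≤-trans (m≤n⊔m b₁ b₂) b≤n))

∪ₘ-swap : (a b c : Maybe ℕ) → a ≡ nothing ⊎ (b ∪ₘ c) ≡ nothing → b ≡ nothing ⊎ c ≡ nothing →
          (b ≡ nothing ⊎ (a ∪ₘ c) ≡ nothing) × (a ∪ₘ (b ∪ₘ c) ≡ b ∪ₘ (a ∪ₘ c))
                                             × (a ≡ nothing ⊎ c ≡ nothing)
∪ₘ-swap nothing  b        c _         b#c = b#c , ≡-refl , inj₁ ≡-refl
∪ₘ-swap (just _) nothing  c (inj₂ c≡) _   = inj₁ ≡-refl , ≡-refl , inj₂ c≡

⊎ₕ-swap : ∀ {h h₁ h₂ h₃ h₄} → h ≡ h₁ ⊎ₕ h₂ → h₂ ≡ h₃ ⊎ₕ h₄ →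
          (h ≡ h₃ ⊎ₕ (h₁ ∪ₕ h₄)) × ((h₁ ∪ₕ h₄) ≡ h₁ ⊎ₕ h₄)
⊎ₕ-swap {h} {h₁} {h₂} {h₃} {h₄} (disj₁₂ , h≡) (disj₃₄ , h₂≡) =
  ((λ n → proj₁ (swapped n)) ,
   (λ n → ≡-trans (h≡ n) (≡-trans (cong (at h₁ n ∪ₘ_) (h₂≡ n)) (proj₁ (proj₂ (swapped n)))))) ,
  ((λ n → proj₂ (proj₂ (swapped n))) , λ _ → ≡-refl)
  where
  swapped : (n : ℕ) → (at h₃ n ≡ nothing ⊎ (at h₁ n ∪ₘ at h₄ n) ≡ nothing)
                    × (at h₁ n ∪ₘ (at h₃ n ∪ₘ at h₄ n) ≡ at h₃ n ∪ₘ (at h₁ n ∪ₘ at h₄ n))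
                    × (at h₁ n ≡ nothing ⊎ at h₄ n ≡ nothing)
  swapped n = ∪ₘ-swap (at h₁ n) (at h₃ n) (at h₄ n)
                    (subst (λ m → at h₁ n ≡ nothing ⊎ m ≡ nothing) (h₂≡ n) (disj₁₂ n)) (disj₃₄ n)

⊨ₛ-swap : ∀ {s h} a b xs → s , h ⊨ₛ (a ∷ b ∷ xs) → s , h ⊨ₛ (b ∷ a ∷ xs)
⊨ₛ-swap {h = h} _ _ _ (h₁ , h₂ , h≡ , ma , (h₃ , h₄ , h₂≡ , mb , mxs)) =
  let h≡′ , h₁₄≡ = ⊎ₕ-swap {h} {h₁} {h₂} {h₃} {h₄} h≡ h₂≡
  in h₃ , h₁ ∪ₕ h₄ , h≡′ , mb , (h₁ , h₄ , h₁₄≡ , ma , mxs)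

⊨ₛ-↭ : ∀ {s h xs ys} → xs ↭ ys → s , h ⊨ₛ xs → s , h ⊨ₛ ys
⊨ₛ-↭ refl m = m
⊨ₛ-↭ (prep x p) (h₁ , h₂ , h≡ , mx , mxs) = h₁ , h₂ , h≡ , mx , ⊨ₛ-↭ p mxs
⊨ₛ-↭ {s} {h} (swap {xs = xs} x y p) m with ⊨ₛ-swap {s} {h} x y xs m
... | h₁ , h₂ , h≡ , my , (h₃ , h₄ , h₂≡ , mx , mxs) =
  h₁ , h₂ , h≡ , my , (h₃ , h₄ , h₂≡ , mx , ⊨ₛ-↭ p mxs)
⊨ₛ-↭ (trans p q) m = ⊨ₛ-↭ q (⊨ₛ-↭ p m)

Disjoint : Heap → Heap → Set
Disjoint h₁ h₂ = ∀ n → InDom h₁ n → InDom h₂ n → ⊥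

nothing≢just : ∀ {v : ℕ} → nothing ≡ just v → ⊥
nothing≢just ()

⊎ₕ⇒Disjoint : ∀ {h h₁ h₂} → h ≡ h₁ ⊎ₕ h₂ → Disjoint h₁ h₂
⊎ₕ⇒Disjoint (disj , _) n (_ , at₁) (_ , at₂) with disj n
... | inj₁ free₁ = nothing≢just (≡-trans (sym free₁) at₁)
... | inj₂ free₂ = nothing≢just (≡-trans (sym free₂) at₂)

⊎ₕ-InDomˡ : ∀ {h h₁ h₂ n} → h ≡ h₁ ⊎ₕ h₂ → InDom h₁ n → InDom h n
⊎ₕ-InDomˡ {h₂ = h₂} {n} (_ , h≡) (v , at₁) = v , ≡-trans (h≡ n) (cong (_∪ₘ at h₂ n) at₁)

⊎ₕ-InDomʳ : ∀ {h h₁ h₂ n} → h ≡ h₁ ⊎ₕ h₂ → InDom h₂ n → InDom h n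
⊎ₕ-InDomʳ {h₂ = h₂} {n} (disj , h≡) (v , at₂) with disj n
... | inj₁ free₁ = v , ≡-trans (h≡ n) (≡-trans (cong (_∪ₘ at h₂ n) free₁) at₂)
... | inj₂ free₂ = ⊥-elim (nothing≢just (≡-trans (sym free₂) at₂))

InDom⇒0< : ∀ {h n} → InDom h n → 0 < n
InDom⇒0< {h} {zero}  (_ , at₀) = ⊥-elim (nothing≢just (≡-trans (sym (at-0 h)) at₀))
InDom⇒0< {n = suc _} _ = s≤s z≤n

Disjoint-⊎ₕˡ : ∀ {h h₂ h₃ h₄} → Disjoint h h₂ → h₂ ≡ h₃ ⊎ₕ h₄ → Disjoint h h₃
Disjoint-⊎ₕˡ {h₂ = h₂} {h₃} {h₄} disj h₂≡ n p q = disj n p (⊎ₕ-InDomˡ {h₂} {h₃} {h₄} h₂≡ q)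

Disjoint-⊎ₕʳ : ∀ {h h₂ h₃ h₄} → Disjoint h h₂ → h₂ ≡ h₃ ⊎ₕ h₄ → Disjoint h h₄
Disjoint-⊎ₕʳ {h₂ = h₂} {h₃} {h₄} disj h₂≡ n p q = disj n p (⊎ₕ-InDomʳ {h₂} {h₃} {h₄} h₂≡ q)

disjoint-intervals-ordered : ∀ {la ha lb hb} → la ≤ ha → lb ≤ hb →
  (∀ n → la ≤ n → n ≤ ha → lb ≤ n → n ≤ hb → ⊥) → ha < lb ⊎ hb < la
disjoint-intervals-ordered {la} {ha} {lb} {hb} la≤ha lb≤hb disjoint with ha <? lb | hb <? la
... | yes ha<lb | _         = inj₁ ha<lb
... | no _      | yes hb<la = inj₂ hb<la
... | no ha≮lb  | no hb≮la  =
  ⊥-elim (disjoint (la ⊔ lb) (m≤m⊔n la lb) (⊔-lub la≤ha (≮⇒≥ ha≮lb))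
                             (m≤n⊔m la lb) (⊔-lub (≮⇒≥ hb≮la) lb≤hb))

NonEmp : Atom → Set
NonEmp emp       = ⊥
NonEmp (_ ↦ _)   = ⊤
NonEmp (Arr _ _) = ⊤

emp-or-NonEmp : (a : Atom) → a ≡ emp ⊎ NonEmp a
emp-or-NonEmp emp       = inj₁ ≡-refl
emp-or-NonEmp (_ ↦ _)   = inj₂ tt
emp-or-NonEmp (Arr _ _) = inj₂ tt

-- First and last location of a non-empty atom; junk value num 0 on emp.
lower upper : Atom → Term
lower emp       = num 0
lower (t ↦ _)   = t
lower (Arr t _) = t
upper emp       = num 0
upper (t ↦ _)   = t
upper (Arr _ u) = u

module Sorting (s : Store) where

  lo hi : Atom → ℕ
  lo a = ⟦ lower a ⟧t s
  hi a = ⟦ upper a ⟧t s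

  ⊨ₐ-interval : ∀ {h} a → NonEmp a → s , h ⊨ₐ a →
                lo a ≤ hi a × (∀ n → lo a ≤ n → n ≤ hi a → InDom h n)
  ⊨ₐ-interval {h} (t ↦ u) _ (at-t , _) =
    ≤-refl , λ n t≤n n≤t → ⟦ u ⟧t s , subst (λ m → at h m ≡ just (⟦ u ⟧t s)) (≤-antisym t≤n n≤t) at-t
  ⊨ₐ-interval (Arr t u) _ (t≤u , dom) = t≤u , λ n t≤n n≤u → proj₂ (dom n) (t≤n , n≤u)

  ⊨ₐ-0<lo : ∀ {h} a → NonEmp a → s , h ⊨ₐ a → 0 < lo a
  ⊨ₐ-0<lo {h} a na ma =
    let lo≤hi , covered = ⊨ₐ-interval a na ma
    in InDom⇒0< {h} (covered (lo a) ≤-refl lo≤hi)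

  ⊨ₐ-ordered : ∀ {h₁ h₂} a b → NonEmp a → NonEmp b → s , h₁ ⊨ₐ a → s , h₂ ⊨ₐ b →
               Disjoint h₁ h₂ → hi a < lo b ⊎ hi b < lo a
  ⊨ₐ-ordered a b na nb ma mb disj =
    let lo≤hiᵃ , coveredᵃ = ⊨ₐ-interval a na ma
        lo≤hiᵇ , coveredᵇ = ⊨ₐ-interval b nb mb
    in disjoint-intervals-ordered lo≤hiᵃ lo≤hiᵇ
         (λ n p q p′ q′ → disj n (coveredᵃ n p q) (coveredᵇ n p′ q′))

  SortedFrom : Term → Spatial → Set
  SortedFrom k xs = (s ⊨ₚ (k <ˢ xs)) × (s ⊨ₚ Sorted′ xs)

  SortedFrom-∷⁻ : ∀ {k xs} b → NonEmp b → SortedFrom k (b ∷ xs) →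
                  ⟦ k ⟧t s < lo b × SortedFrom (upper b) xs
  SortedFrom-∷⁻ (_ ↦ _)   _ (k<b , sorted)       = k<b , sorted
  SortedFrom-∷⁻ (Arr _ _) _ (k<b , (_ , sorted)) = k<b , sorted

  SortedFrom-∷⁺ : ∀ {k xs} b → NonEmp b → ⟦ k ⟧t s < lo b → lo b ≤ hi b →
                  SortedFrom (upper b) xs → SortedFrom k (b ∷ xs)
  SortedFrom-∷⁺ (_ ↦ _)   _ k<b _     sorted = k<b , sorted
  SortedFrom-∷⁺ (Arr _ _) _ k<b lo≤hi sorted = k<b , (lo≤hi , sorted)

  insert : ∀ {k h₁ h₂} a ys → NonEmp a → s , h₁ ⊨ₐ a → s , h₂ ⊨ₛ ys → Disjoint h₁ h₂ →
           ⟦ k ⟧t s < lo a → SortedFrom k ys → ∃ λ zs → (a ∷ ys) ↭ zs × SortedFrom k zs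
  insert a [] na ma _ _ k<a _ =
    a ∷ [] , refl , SortedFrom-∷⁺ a na k<a (proj₁ (⊨ₐ-interval a na ma)) (tt , tt)
  insert {h₁ = h₁} {h₂} a (b ∷ ys) na ma (h₃ , h₄ , h₂≡ , mb , mys) disj k<a sorted
    with emp-or-NonEmp b
  ... | inj₁ ≡-refl =
    let zs , p , sorted′ = insert a ys na ma mys (Disjoint-⊎ₕʳ {h₁} {h₂} {h₃} {h₄} disj h₂≡) k<a sorted
    in emp ∷ zs , trans (swap a emp refl) (prep emp p) , sorted′
  ... | inj₂ nb
    with SortedFrom-∷⁻ b nb sorted
       | ⊨ₐ-ordered a b na nb ma mb (Disjoint-⊎ₕˡ {h₁} {h₂} {h₃} {h₄} disj h₂≡)
  ...  | _ , sortedᵇ | inj₁ a<b =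
    a ∷ b ∷ ys , refl ,
    SortedFrom-∷⁺ a na k<a (proj₁ (⊨ₐ-interval a na ma))
      (SortedFrom-∷⁺ b nb a<b (proj₁ (⊨ₐ-interval b nb mb)) sortedᵇ)
  ...  | k<b , sortedᵇ | inj₂ b<a =
    let zs , p , sorted′ = insert a ys na ma mys (Disjoint-⊎ₕʳ {h₁} {h₂} {h₃} {h₄} disj h₂≡) b<a sortedᵇ
    in b ∷ zs , trans (swap a b refl) (prep b p) ,
       SortedFrom-∷⁺ b nb k<b (proj₁ (⊨ₐ-interval b nb mb)) sorted′

  sort : ∀ {h} xs → s , h ⊨ₛ xs → ∃ λ ys → xs ↭ ys × s ⊨ₚ Sorted ys
  sort [] _ = [] , refl , tt , tt
  sort {h} (a ∷ xs) (h₁ , h₂ , h≡ , ma , mxs) with sort xs mxs | emp-or-NonEmp a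
  ... | ys , p , sorted | inj₁ ≡-refl = emp ∷ ys , prep emp p , sorted
  ... | ys , p , sorted | inj₂ na =
    let zs , q , sorted′ = insert a ys na ma (⊨ₛ-↭ p mxs) (⊎ₕ⇒Disjoint {h} {h₁} {h₂} h≡)
                             (⊨ₐ-0<lo a na ma) sorted
    in zs , trans (prep a p) q , sorted′

∈Perm-sym : ∀ {φ ψ : SymHeap} → ψ ∈Perm φ → φ ∈Perm ψ
∈Perm-sym (vars≡ , pure≡ , σ↭) = sym vars≡ , sym pure≡ , ↭-sym σ↭

⊨-∈Perm : ∀ {s h} φ ψ → ψ ∈Perm φ → s , h ⊨ φ → s , h ⊨ ψ
⊨-∈Perm {s} _ _ (vars≡ , pure≡ , σ↭) (s′ , agree , mΠ , mΣ) =
  s′ , subst (λ xs → AgreeOutside xs s s′) (sym vars≡) agree ,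
  subst (s′ ⊨ₚ_) (sym pure≡) mΠ , ⊨ₛ-↭ σ↭ mΣ

⊨-tilde⇒⊨ : ∀ {s h} φ → s , h ⊨ tilde φ → s , h ⊨ φ
⊨-tilde⇒⊨ _ (s′ , agree , (mΠ , _) , mΣ) = s′ , agree , mΠ , mΣ

⊨⇒⊨-tilde-∈Perm : ∀ {s h} φ → s , h ⊨ φ → Σ SymHeap λ ψ → ψ ∈Perm φ × s , h ⊨ tilde ψ
⊨⇒⊨-tilde-∈Perm φ (s′ , agree , mΠ , mΣ) =
  let ys , σ↭ , sorted = Sorting.sort s′ (spatial φ) mΣ
  in ∃[ vars φ ]⟨ pure φ ∧ ys ⟩ , (≡-refl , ≡-refl , σ↭) ,
     (s′ , agree , (mΠ , sorted) , ⊨ₛ-↭ σ↭ mΣ)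

lemma1 : (φ : SymHeap) → QF φ → (n : ℕ) → (ϕ : Fin n → SymHeap) → (s : Store) →
    ((h : Heap) → s , h ⊨ φ → Σ (Fin n) λ i → s , h ⊨ ϕ i)
    ⇔ ((φ′ : SymHeap) → φ′ ∈Perm φ → (h : Heap) → s , h ⊨ tilde φ′ →
         Σ (Fin n) λ i → Σ SymHeap λ ψ → (ψ ∈Perm ϕ i) × (s , h ⊨ tilde ψ))
lemma1 φ _ n ϕ s = mk⇔ sorted-entailment entailment
  where
  Entails Entails-sorted : Set
  Entails = (h : Heap) → s , h ⊨ φ → Σ (Fin n) λ i → s , h ⊨ ϕ i
  Entails-sorted = (φ′ : SymHeap) → φ′ ∈Perm φ → (h : Heap) → s , h ⊨ tilde φ′ →
                   Σ (Fin n) λ i → Σ SymHeap λ ψ → (ψ ∈Perm ϕ i) × (s , h ⊨ tilde ψ)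

  sorted-entailment : Entails → Entails-sorted
  sorted-entailment entails φ′ φ′∈ h m =
    let i , mᵢ = entails h (⊨-∈Perm φ′ φ (∈Perm-sym {φ} {φ′} φ′∈) (⊨-tilde⇒⊨ φ′ m))
    in i , ⊨⇒⊨-tilde-∈Perm (ϕ i) mᵢ

  entailment : Entails-sorted → Entails
  entailment entails h m =
    let φ′ , φ′∈ , m′ = ⊨⇒⊨-tilde-∈Perm φ m
        i , ψ , ψ∈ , mψ = entails φ′ φ′∈ h m′
    in i , ⊨-∈Perm ψ (ϕ i) (∈Perm-sym {ϕ i} {ψ} ψ∈) (⊨-tilde⇒⊨ ψ mψ)
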